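{- Let $P$ be a polyomino with $n=2m-1$ tiles that admits a set $S$ of $m=\lceil n/2\rceil$ non-attacking rooks. Then $S$ dominates $P$, and $S$ is the only set of $m$ non-attacking rooks on $P$.
   Context: A polyomino is a finite union of unit squares (tiles) of the standard grid in $\mathbb{R}^2$ with connected interior. Two tiles of $P$ are in the same row (resp. column) of $P$ if the segment joining their centers is horizontal (resp. vertical) and contained in $P$. A rook on a tile guards that tile and every tile in the same row or column of $P$. A set of rooks dominates $P$ if every tile is guarded by some rook. A set of rooks on distinct tiles is non-attacking if no two are in the same row or column of $P$. -}

module Defs where

open import Data.Integer using (ℤ; _+_; _≤_; _⊓_; _⊔_; 1ℤ)
open import Data.Product using (_×_; _,_; ∃-syntax)
open import Data.Sum using (_⊎_)
open import Data.List using (List; [])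
open import Data.List.Membership.Propositional using (_∈_)
open import Data.List.Relation.Unary.Unique.Propositional using (Unique)
open import Relation.Binary.PropositionalEquality using (_≡_; _≢_)
open import Relation.Nullary using (¬_)

-- A tile is the unit square [x, x+1] × [y, y+1], identified with (x , y).
Tile : Set
Tile = ℤ × ℤ

Tiles : Set
Tiles = List Tile

Adjacent : Tile → Tile → Set
Adjacent (x , y) (x' , y') =
  (y ≡ y' × (x' ≡ x + 1ℤ ⊎ x ≡ x' + 1ℤ)) ⊎ (x ≡ x' × (y' ≡ y + 1ℤ ⊎ y ≡ y' + 1ℤ))

data Reach (P : Tiles) : Tile → Tile → Set where
  here : ∀ {t} → Reach P t t
  step : ∀ {t u v} → u ∈ P → Adjacent t u → Reach P u v → Reach P t v

-- A polyomino: a nonempty finite set of tiles whose union has connected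
-- interior, i.e. whose tiles are connected through shared edges.
record IsPolyomino (P : Tiles) : Set where
  field
    distinct  : Unique P
    nonempty  : ∃[ t ] (t ∈ P)
    connected : ∀ {t u} → t ∈ P → u ∈ P → Reach P t u

-- The segment joining the centers of (x₁,y) and (x₂,y) lies in P iff
-- every tile (x,y) with x between x₁ and x₂ is in P.
SameRow : Tiles → Tile → Tile → Set
SameRow P (x₁ , y₁) (x₂ , y₂) =
  y₁ ≡ y₂ × (∀ x → x₁ ⊓ x₂ ≤ x → x ≤ x₁ ⊔ x₂ → (x , y₁) ∈ P)

SameColumn : Tiles → Tile → Tile → Set
SameColumn P (x₁ , y₁) (x₂ , y₂) =
  x₁ ≡ x₂ × (∀ y → y₁ ⊓ y₂ ≤ y → y ≤ y₁ ⊔ y₂ → (x₁ , y) ∈ P)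

Guards : Tiles → Tile → Tile → Set
Guards P r t = r ≡ t ⊎ SameRow P r t ⊎ SameColumn P r t

IsRookSet : Tiles → List Tile → Set
IsRookSet P S = Unique S × (∀ {r} → r ∈ S → r ∈ P)

NonAttacking : Tiles → List Tile → Set
NonAttacking P S =
  ∀ {r r'} → r ∈ S → r' ∈ S → r ≢ r' → ¬ SameRow P r r' × ¬ SameColumn P r r'

Dominates : Tiles → List Tile → Set
Dominates P S = ∀ {t} → t ∈ P → ∃[ r ] (r ∈ S × Guards P r t)

module Submission where

-- View the rows and columns of P as the vertices of a bipartite graph whose edges are the
-- tiles. Since P is connected, adding its tiles one at a time along edge-adjacencies shows
-- that at most |P| + 1 lines cover all tiles, and at most |P| if some set of tiles closes a
-- cycle. Non-attacking rooks occupy pairwise distinct lines, so m of them occupy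
-- 2m = |P| + 1 lines, i.e. every line: this is domination. If S′ had a rook outside S, the
-- alternating walk (along its row to a rook of S, along that rook's column to a rook of S′, …)
-- would close a cycle, so P would be covered by |P| lines, too few to carry the lines of S.

open import Data.Empty using (⊥; ⊥-elim)
open import Data.Integer as ℤ using (ℤ; 1ℤ; _⊓_; _⊔_)
import Data.Integer.Properties as ℤ
open import Data.List using (List; []; _∷_; length; map; _++_)
open import Data.List.Properties using (length-++; length-map; length-removeAt′)
open import Data.List.Membership.Propositional using (_∈_; _∉_; find; lose)
open import Data.List.Relation.Unary.All as All using (All; []; _∷_)
import Data.List.Relation.Unary.All.Properties as Allₚ
open import Data.List.Relation.Unary.AllPairs using (AllPairs; []; _∷_)
import Data.List.Relation.Unary.AllPairs.Properties as AllPairsₚ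
open import Data.List.Relation.Unary.Any as Any using (Any; here; there; _─_; index)
import Data.List.Relation.Unary.Any.Properties as Anyₚ
open import Data.List.Relation.Unary.Unique.Propositional using (Unique)
open import Data.Nat using (ℕ; zero; suc; _+_; _*_; _≤_; _<_; s≤s; s≤s⁻¹)
open import Data.Nat.Properties
  using (≮⇒≥; <⇒≱; ≤-trans; ≤-reflexive; +-suc; +-comm; +-identityʳ; +-monoʳ-≤; +-monoˡ-≤; +-cancelʳ-≤; m≤n+m;
         module ≤-Reasoning)
open import Data.Product using (_×_; _,_; proj₁; proj₂; ∃₂; ∃-syntax; Σ)
open import Data.Product.Properties using (≡-dec)
open import Data.Sum as Sum using (_⊎_; inj₁; inj₂)
open import Level using (0ℓ) renaming (_⊔_ to _⊔ˡ_)
open import Relation.Binary.Bundles using (PartialSetoid; Setoid)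
open import Relation.Binary.Definitions using (DecidableEquality)
open import Relation.Binary.PropositionalEquality as ≡ using (_≡_; _≢_; refl; subst)
open import Relation.Nullary using (¬_; ¬?; yes; no)
open import Relation.Nullary.Decidable using (decidable-stable)

open import Defs

_≟ᵗ_ : DecidableEquality Tile
_≟ᵗ_ = ≡-dec ℤ._≟_ ℤ._≟_

open import Data.List.Membership.DecPropositional _≟ᵗ_ using (_∈?_)

module Repetition {a ℓ} (S : PartialSetoid a ℓ) where

  open PartialSetoid S renaming (Carrier to A)

  _∈≈_ : A → List A → Set (a ⊔ˡ ℓ)
  x ∈≈ xs = Any (x ≈_) xs

  data Repeats : List A → Set (a ⊔ˡ ℓ) where
    here  : ∀ {x xs} → x ∈≈ xs → Repeats (x ∷ xs)
    there : ∀ {x xs} → Repeats xs → Repeats (x ∷ xs)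

  Distinct : List A → Set (a ⊔ˡ ℓ)
  Distinct = AllPairs (λ x y → ¬ x ≈ y)

  Repeats⇒¬Distinct : ∀ {xs} → Repeats xs → ¬ Distinct xs
  Repeats⇒¬Distinct (here x∈xs)  (x≉xs ∷ _) = Allₚ.All¬⇒¬Any x≉xs x∈xs
  Repeats⇒¬Distinct (there rep) (_ ∷ xs!)  = Repeats⇒¬Distinct rep xs!

  ∈≈-resp-≈ : ∀ {x y ys} → x ≈ y → y ∈≈ ys → x ∈≈ ys
  ∈≈-resp-≈ x≈y = Any.map (trans x≈y)

  ≈⊎∈≈-─ : ∀ {x y ys} → x ∈≈ ys → (y∈ys : y ∈≈ ys) → x ≈ y ⊎ x ∈≈ (ys ─ y∈ys)
  ≈⊎∈≈-─ (here x≈z)  (here y≈z)  = inj₁ (trans x≈z (sym y≈z))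
  ≈⊎∈≈-─ (here x≈z)  (there _)   = inj₂ (here x≈z)
  ≈⊎∈≈-─ (there x∈ys) (here _)    = inj₂ x∈ys
  ≈⊎∈≈-─ (there x∈ys) (there y∈ys) = Sum.map₂ there (≈⊎∈≈-─ x∈ys y∈ys)

  ∈≈⊎All-─ : ∀ {x ys zs} (x∈ys : x ∈≈ ys) → All (_∈≈ ys) zs → x ∈≈ zs ⊎ All (_∈≈ (ys ─ x∈ys)) zs
  ∈≈⊎All-─ x∈ys [] = inj₂ []
  ∈≈⊎All-─ x∈ys (z∈ys ∷ zs⊆ys) with ≈⊎∈≈-─ z∈ys x∈ys | ∈≈⊎All-─ x∈ys zs⊆ys
  ... | inj₁ z≈x     | _              = inj₁ (here (sym z≈x))
  ... | inj₂ _       | inj₁ x∈zs      = inj₁ (there x∈zs)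
  ... | inj₂ z∈ys─x  | inj₂ zs⊆ys─x   = inj₂ (z∈ys─x ∷ zs⊆ys─x)

  pigeonhole : ∀ {xs ys} → All (_∈≈ ys) xs → length ys < length xs → Repeats xs
  pigeonhole {x ∷ xs} {ys} (x∈ys ∷ xs⊆ys) |ys|<|x∷xs| with ∈≈⊎All-─ x∈ys xs⊆ys
  ... | inj₁ x∈xs    = here x∈xs
  ... | inj₂ xs⊆ys─x = there (pigeonhole xs⊆ys─x
          (subst (_≤ length xs) (length-removeAt′ ys (index x∈ys)) (s≤s⁻¹ |ys|<|x∷xs|)))

Unique⇒length≤ : ∀ {A : Set} {xs ys : List A} → Unique xs → All (_∈ ys) xs → length xs ≤ length ys
Unique⇒length≤ {A} xs! xs⊆ys = ≮⇒≥ (λ |ys|<|xs| → Repeats⇒¬Distinct (pigeonhole xs⊆ys |ys|<|xs|) xs!)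
  where open Repetition (Setoid.partialSetoid (≡.setoid A))

Segment : (ℤ → Set) → ℤ → ℤ → Set
Segment Q a b = ∀ z → a ⊓ b ℤ.≤ z → z ℤ.≤ a ⊔ b → Q z

between-split : ∀ a b c z → a ⊓ c ℤ.≤ z → z ℤ.≤ a ⊔ c →
  (a ⊓ b ℤ.≤ z × z ℤ.≤ a ⊔ b) ⊎ (b ⊓ c ℤ.≤ z × z ℤ.≤ b ⊔ c)
between-split a b c z lo hi with ℤ.≤-total z b
... | inj₁ z≤b with ℤ.⊓-sel a c
...   | inj₁ a⊓c≡a = inj₁ (ℤ.≤-trans (ℤ.i⊓j≤i a b) (subst (ℤ._≤ z) a⊓c≡a lo) , ℤ.≤-trans z≤b (ℤ.i≤j⊔i a b))
...   | inj₂ a⊓c≡c = inj₂ (ℤ.≤-trans (ℤ.i⊓j≤j b c) (subst (ℤ._≤ z) a⊓c≡c lo) , ℤ.≤-trans z≤b (ℤ.i≤i⊔j b c))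
between-split a b c z lo hi | inj₂ b≤z with ℤ.⊔-sel a c
...   | inj₁ a⊔c≡a = inj₁ (ℤ.≤-trans (ℤ.i⊓j≤j a b) b≤z , ℤ.≤-trans (subst (z ℤ.≤_) a⊔c≡a hi) (ℤ.i≤i⊔j a b))
...   | inj₂ a⊔c≡c = inj₂ (ℤ.≤-trans (ℤ.i⊓j≤i b c) b≤z , ℤ.≤-trans (subst (z ℤ.≤_) a⊔c≡c hi) (ℤ.i≤j⊔i b c))

between-successor : ∀ a z → a ⊓ (a ℤ.+ 1ℤ) ℤ.≤ z → z ℤ.≤ a ⊔ (a ℤ.+ 1ℤ) → z ≡ a ⊎ z ≡ a ℤ.+ 1ℤ
between-successor a z lo hi with z ℤ.≤? a
... | yes z≤a = inj₁ (ℤ.≤-antisym z≤a (subst (ℤ._≤ z) (ℤ.i≤j⇒i⊓j≡i (ℤ.i≤i+j a 1ℤ)) lo))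
... | no z≰a = inj₂ (ℤ.≤-antisym (subst (z ℤ.≤_) (ℤ.i≤j⇒i⊔j≡j (ℤ.i≤i+j a 1ℤ)) hi)
                                 (subst (ℤ._≤ z) (ℤ.+-comm 1ℤ a) (ℤ.i<j⇒suc[i]≤j (ℤ.≰⇒> z≰a))))

module _ (Q : ℤ → Set) where

  segment-refl : ∀ {a} → Q a → Segment Q a a
  segment-refl {a} qa z lo hi =
    subst Q (ℤ.≤-antisym (subst (ℤ._≤ z) (ℤ.⊓-idem a) lo) (subst (z ℤ.≤_) (ℤ.⊔-idem a) hi)) qa

  segment-sym : ∀ {a b} → Segment Q a b → Segment Q b a
  segment-sym {a} {b} seg z lo hi =
    seg z (subst (ℤ._≤ z) (ℤ.⊓-comm b a) lo) (subst (z ℤ.≤_) (ℤ.⊔-comm b a) hi)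

  segment-trans : ∀ {a b c} → Segment Q a b → Segment Q b c → Segment Q a c
  segment-trans {a} {b} {c} ab bc z lo hi with between-split a b c z lo hi
  ... | inj₁ (lo′ , hi′) = ab z lo′ hi′
  ... | inj₂ (lo′ , hi′) = bc z lo′ hi′

  segment-successor : ∀ {a} → Q a → Q (a ℤ.+ 1ℤ) → Segment Q a (a ℤ.+ 1ℤ)
  segment-successor {a} qa qa+1 z lo hi with between-successor a z lo hi
  ... | inj₁ refl = qa
  ... | inj₂ refl = qa+1

  segment-unit : ∀ {a b} → b ≡ a ℤ.+ 1ℤ ⊎ a ≡ b ℤ.+ 1ℤ → Q a → Q b → Segment Q a b
  segment-unit (inj₁ refl) qa qb = segment-successor qa qb
  segment-unit (inj₂ refl) qa qb = segment-sym (segment-successor qb qa)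

data Axis : Set where
  horizontal vertical : Axis

perpendicular : Axis → Axis
perpendicular horizontal = vertical
perpendicular vertical   = horizontal

perpendicular-involutive : ∀ a → perpendicular (perpendicular a) ≡ a
perpendicular-involutive horizontal = refl
perpendicular-involutive vertical   = refl

-- (a , t) names the row (a = horizontal) or column of P through t;
-- `Lines._≈_` relates two names of the same line.
Line : Set
Line = Axis × Tile

along : Axis → Tile → Line
along = _,_

module Lines (P : Tiles) where

  infix 4 _≈_
  _≈_ : Line → Line → Set
  (horizontal , s) ≈ (horizontal , t) = SameRow P s t
  (vertical   , s) ≈ (vertical   , t) = SameColumn P s t
  (horizontal , _) ≈ (vertical   , _) = ⊥
  (vertical   , _) ≈ (horizontal , _) = ⊥

  ≈-refl : ∀ {a t} → t ∈ P → (a , t) ≈ (a , t)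
  ≈-refl {horizontal} {_ , y} t∈P = refl , segment-refl (λ x → (x , y) ∈ P) t∈P
  ≈-refl {vertical}   {x , _} t∈P = refl , segment-refl (λ y → (x , y) ∈ P) t∈P

  ≈-sym : ∀ {ℓ ℓ′} → ℓ ≈ ℓ′ → ℓ′ ≈ ℓ
  ≈-sym {horizontal , _ , y} {horizontal , _} (refl , seg) = refl , segment-sym (λ x → (x , y) ∈ P) seg
  ≈-sym {vertical   , x , _} {vertical   , _} (refl , seg) = refl , segment-sym (λ y → (x , y) ∈ P) seg

  ≈-trans : ∀ {ℓ ℓ′ ℓ″} → ℓ ≈ ℓ′ → ℓ′ ≈ ℓ″ → ℓ ≈ ℓ″
  ≈-trans {horizontal , _ , y} {horizontal , _} {horizontal , _} (refl , seg) (refl , seg′) =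
    refl , segment-trans (λ x → (x , y) ∈ P) seg seg′
  ≈-trans {vertical   , x , _} {vertical   , _} {vertical   , _} (refl , seg) (refl , seg′) =
    refl , segment-trans (λ y → (x , y) ∈ P) seg seg′

  partialSetoid : PartialSetoid 0ℓ 0ℓ
  partialSetoid = record
    { _≈_ = _≈_
    ; isPartialEquivalence = record { sym = ≈-sym ; trans = ≈-trans }
    }

  open Repetition partialSetoid public
    using (_∈≈_; Repeats; here; there; Distinct; Repeats⇒¬Distinct; ∈≈-resp-≈; pigeonhole)

  adjacent⇒≈ : ∀ {s t} → s ∈ P → t ∈ P → Adjacent s t → ∃[ a ] (a , s) ≈ (a , t)
  adjacent⇒≈ {_ , y} s∈P t∈P (inj₁ (refl , d)) = horizontal , refl , segment-unit (λ x → (x , y) ∈ P) d s∈P t∈P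
  adjacent⇒≈ {x , _} s∈P t∈P (inj₂ (refl , d)) = vertical , refl , segment-unit (λ y → (x , y) ∈ P) d s∈P t∈P

  Covers : List Line → Tile → Set
  Covers G t = ∀ a → (a , t) ∈≈ G

  covers-both : ∀ a {G t} → (a , t) ∈≈ G → (perpendicular a , t) ∈≈ G → Covers G t
  covers-both horizontal h v horizontal = h
  covers-both horizontal h v vertical   = v
  covers-both vertical   v h horizontal = h
  covers-both vertical   v h vertical   = v

  covers-∷ : ∀ {ℓ G t} → Covers G t → Covers (ℓ ∷ G) t
  covers-∷ cov a = there (cov a)

  record PartialCovering : Set where
    field
      tiles    : List Tile
      lines    : List Line
      nonempty : ∃[ t ] t ∈ tiles
      distinct : Unique tiles
      inside   : All (_∈ P) tiles
      covered  : All (Covers lines) tiles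

  rookLines : List Tile → List Line
  rookLines S = map (along horizontal) S ++ map (along vertical) S

  length-rookLines : ∀ S → length (rookLines S) ≡ length S + length S
  length-rookLines S = ≡.trans (length-++ (map (along horizontal) S))
                                (≡.cong₂ _+_ (length-map (along horizontal) S) (length-map (along vertical) S))

  nonAttacking⇒≉ : ∀ {S r r′} → NonAttacking P S → r ∈ S → r′ ∈ S → r ≢ r′ → ∀ a → ¬ (a , r) ≈ (a , r′)
  nonAttacking⇒≉ na r∈S r′∈S r≢r′ horizontal = proj₁ (na r∈S r′∈S r≢r′)
  nonAttacking⇒≉ na r∈S r′∈S r≢r′ vertical   = proj₂ (na r∈S r′∈S r≢r′)

  nonAttacking⇒distinct-along : ∀ a {S} → Unique S → NonAttacking P S →
                                AllPairs (λ r r′ → ¬ (a , r) ≈ (a , r′)) S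
  nonAttacking⇒distinct-along a [] na = []
  nonAttacking⇒distinct-along a (r∉S ∷ S!) na =
    All.tabulate (λ r′∈S → nonAttacking⇒≉ na (here refl) (there r′∈S) (All.lookup r∉S r′∈S) a)
    ∷ nonAttacking⇒distinct-along a S! (λ r∈S r′∈S → na (there r∈S) (there r′∈S))

  nonAttacking⇒distinct : ∀ {S} → Unique S → NonAttacking P S → Distinct (rookLines S)
  nonAttacking⇒distinct {S} S! na = AllPairsₚ.++⁺
    (AllPairsₚ.map⁺ (nonAttacking⇒distinct-along horizontal S! na))
    (AllPairsₚ.map⁺ (nonAttacking⇒distinct-along vertical S! na))
    (Allₚ.map⁺ (All.universal (λ _ → Allₚ.map⁺ (All.universal (λ _ ()) S)) S))

  Covering : List Line → Set
  Covering G = ∀ {t} → t ∈ P → Covers G t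

  rookLines⊆ : ∀ {S G} → (∀ {r} → r ∈ S → r ∈ P) → Covering G → All (_∈≈ G) (rookLines S)
  rookLines⊆ S⊆P cov = Allₚ.++⁺ (Allₚ.map⁺ (All.tabulate (λ r∈S → cov (S⊆P r∈S) horizontal)))
                                (Allₚ.map⁺ (All.tabulate (λ r∈S → cov (S⊆P r∈S) vertical)))

  ≈⇒same-axis : ∀ {a b s t} → (a , s) ≈ (b , t) → (a , s) ≈ (a , t)
  ≈⇒same-axis {horizontal} {horizontal} s≈t = s≈t
  ≈⇒same-axis {vertical}   {vertical}   s≈t = s≈t

  ∈≈-map-along⁻ : ∀ {a b t S} → (a , t) ∈≈ map (along b) S → ∃[ r ] r ∈ S × (a , r) ≈ (a , t)
  ∈≈-map-along⁻ t∈ with find (Anyₚ.map⁻ t∈)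
  ... | r , r∈S , t≈r = r , r∈S , ≈-sym (≈⇒same-axis t≈r)

  ∈≈-rookLines⁻ : ∀ {a t} S → (a , t) ∈≈ rookLines S → ∃[ r ] r ∈ S × (a , r) ≈ (a , t)
  ∈≈-rookLines⁻ S t∈ = Sum.[ ∈≈-map-along⁻ , ∈≈-map-along⁻ ] (Anyₚ.++⁻ (map (along horizontal) S) t∈)

  nonAttacking⇒covering-length≥ : ∀ {S G} → IsRookSet P S → NonAttacking P S → Covering G →
                                  length S + length S ≤ length G
  nonAttacking⇒covering-length≥ {S} (S! , S⊆P) na cov = ≮⇒≥ λ |G|<2|S| →
    Repeats⇒¬Distinct (pigeonhole (rookLines⊆ S⊆P cov) (subst (_ <_) (≡.sym (length-rookLines S)) |G|<2|S|))
                      (nonAttacking⇒distinct S! na)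

  rook-on-every-line : ∀ {S G} → IsRookSet P S → NonAttacking P S →
                       Covering G → length G ≤ length S + length S →
                       ∀ {t} → t ∈ P → ∀ a → ∃[ r ] r ∈ S × (a , r) ≈ (a , t)
  rook-on-every-line {S} (S! , S⊆P) na cov |G|≤2|S| t∈P a
    with pigeonhole (cov t∈P a ∷ rookLines⊆ S⊆P cov) (s≤s (subst (_ ≤_) (≡.sym (length-rookLines S)) |G|≤2|S|))
  ... | here t∈rookLines = ∈≈-rookLines⁻ S t∈rookLines
  ... | there rep        = ⊥-elim (Repeats⇒¬Distinct rep (nonAttacking⇒distinct S! na))

  ∉⇒length< : ∀ {u L} → Unique L → All (_∈ P) L → u ∈ P → u ∉ L → length L < length P
  ∉⇒length< {L = L} L! L⊆P u∈P u∉L = Unique⇒length≤ (Allₚ.¬Any⇒All¬ L u∉L ∷ L!) (u∈P ∷ L⊆P)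

  boundary-edge : ∀ {L s t} → Reach P s t → s ∈ L → t ∉ L → ∃₂ λ u v → u ∈ P × u ∉ L × v ∈ L × Adjacent v u
  boundary-edge here s∈L t∉L = ⊥-elim (t∉L s∈L)
  boundary-edge {L} (step {u = u} u∈P s~u path) s∈L t∉L with u ∈? L
  ... | yes u∈L = boundary-edge path u∈L t∉L
  ... | no  u∉L = u , _ , u∈P , u∉L , s∈L , s~u

  covers-adjoined : ∀ a {G u v} → u ∈ P → (a , v) ≈ (a , u) → Covers G v → Covers ((perpendicular a , u) ∷ G) u
  covers-adjoined a u∈P v≈u cov = covers-both a (there (∈≈-resp-≈ (≈-sym v≈u) (cov a))) (here (≈-refl u∈P))

  DeficientCovering : Set
  DeficientCovering = Σ PartialCovering λ C →
    length (PartialCovering.lines C) ≤ length (PartialCovering.tiles C)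

  -- Non-attacking rooks on such an S occupy |P| + 1 lines, the most P can have (`covering-through`).
  Saturated : List Tile → Set
  Saturated S = length S + length S ≡ suc (length P)

  saturated⇒length< : ∀ {S G} → IsRookSet P S → NonAttacking P S → Saturated S →
                      Covering G → length P < length G
  saturated⇒length< rs na saturated cov =
    ≤-trans (≤-reflexive (≡.sym saturated)) (nonAttacking⇒covering-length≥ rs na cov)

  module Alternation (R : Axis → List Tile)
                     (R⊆P : ∀ a {r} → r ∈ R a → r ∈ P)
                     (R-nonAttacking : ∀ a → NonAttacking P (R a))
                     (rook : ∀ a {t} → t ∈ P → ∃[ r ] r ∈ R a × (a , r) ≈ (a , t)) where

    -- A walk that reached its head along axis a: `lines` covers every visited tile and the
    -- line of arrival, using one line per tile.
    record Trail (a : Axis) : Set where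
      constructor trail
      field
        head     : Tile
        visited  : List Tile
        lines    : List Line
        fresh    : head ∈ R a × head ∉ R (perpendicular a)
        distinct : Unique (head ∷ visited)
        inside   : All (_∈ P) (head ∷ visited)
        covered  : All (Covers lines) visited
        arrival  : (a , head) ∈≈ lines
        size     : length lines ≡ suc (length visited)

    next-rook : ∀ a {x} → x ∈ P → x ∈ R a → x ∉ R (perpendicular a) →
                ∃[ y ] y ∈ P × y ∈ R (perpendicular a) × y ∉ R a ×
                       (perpendicular a , y) ≈ (perpendicular a , x) × y ≢ x
    next-rook a {x} x∈P x∈R x∉R′ with rook (perpendicular a) x∈P
    ... | y , y∈R′ , y≈x = y , R⊆P _ y∈R′ , y∈R′ , y∉R , y≈x , y≢x
      where
        y≢x : y ≢ x
        y≢x refl = x∉R′ y∈R′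
        y∉R : y ∉ R a
        y∉R y∈R = nonAttacking⇒≉ (R-nonAttacking a) y∈R x∈R y≢x (perpendicular a) y≈x

    walk : ∀ {a} fuel (T : Trail a) → length P ≤ suc (length (Trail.visited T)) + fuel → DeficientCovering
    walk {a} fuel (trail x W G (x∈R , x∉R′) xW! xW⊆P W-covered arrival size) bound
      with next-rook a (All.lookup xW⊆P (here refl)) x∈R x∉R′
    ... | y , y∈P , y∈R′ , y∉R , y≈x , y≢x with y ∈? (x ∷ W) | fuel
    ...   | yes (here y≡x)  | _ = ⊥-elim (y≢x y≡x)
    -- y was visited before, so the line shared by x and y is already covered: a cycle closes.
    ...   | yes (there y∈W) | _ = closed , ≤-reflexive size
      where
        closed : PartialCovering
        closed = record
          { tiles    = x ∷ W
          ; lines    = G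
          ; nonempty = x , here refl
          ; distinct = xW!
          ; inside   = xW⊆P
          ; covered  = covers-both a arrival
                         (∈≈-resp-≈ (≈-sym y≈x) (All.lookup W-covered y∈W (perpendicular a)))
                       ∷ W-covered
          }
    ...   | no y∉xW | zero =
      ⊥-elim (<⇒≱ (∉⇒length< xW! xW⊆P y∈P y∉xW) (subst (length P ≤_) (+-identityʳ _) bound))
    ...   | no y∉xW | suc fuel′ = walk fuel′ extended (subst (length P ≤_) (+-suc (suc (length W)) fuel′) bound)
      where
        extended : Trail (perpendicular a)
        extended = trail y (x ∷ W) ((perpendicular a , x) ∷ G)
          (y∈R′ , subst (λ b → y ∉ R b) (≡.sym (perpendicular-involutive a)) y∉R)
          (Allₚ.¬Any⇒All¬ (x ∷ W) y∉xW ∷ xW!)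
          (y∈P ∷ xW⊆P)
          (covers-both a (there arrival) (here (≈-refl (All.lookup xW⊆P (here refl))))
           ∷ All.map covers-∷ W-covered)
          (here y≈x)
          (≡.cong suc size)

    deficient-covering : ∀ a {x} → x ∈ R a → x ∉ R (perpendicular a) → DeficientCovering
    deficient-covering a {x} x∈R x∉R′ =
      walk (length P) (trail x [] ((a , x) ∷ []) (x∈R , x∉R′) ([] ∷ []) (x∈P ∷ []) [] (here (≈-refl x∈P)) refl)
           (m≤n+m (length P) 1)
      where
        x∈P : x ∈ P
        x∈P = R⊆P a x∈R

  module Connected (connected : ∀ {t u} → t ∈ P → u ∈ P → Reach P t u) where

    full-or-boundary : ∀ {L s} → s ∈ L → All (_∈ P) L →
                       (∀ {u} → u ∈ P → u ∈ L) ⊎ ∃₂ λ u v → u ∈ P × u ∉ L × v ∈ L × Adjacent v u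
    full-or-boundary {L} s∈L L⊆P with Any.any? (λ u → ¬? (u ∈? L)) P
    ... | yes outside = let u , u∈P , u∉L = find outside in
                        inj₂ (boundary-edge (connected (All.lookup L⊆P s∈L) u∈P) s∈L u∉L)
    ... | no  none    = inj₁ λ {u} u∈P → decidable-stable (u ∈? L) (λ u∉L → none (lose u∈P u∉L))

    open PartialCovering

    extend-covering : ∀ fuel (C : PartialCovering) → length P ≤ length (tiles C) + fuel →
             ∃[ G ] Covering G × length G + length (tiles C) ≤ length (lines C) + length P
    extend-covering fuel C bound with full-or-boundary (proj₂ (nonempty C)) (inside C) | fuel
    ... | inj₁ P⊆L | _ = lines C , (λ u∈P → All.lookup (covered C) (P⊆L u∈P)) ,
                         +-monoʳ-≤ (length (lines C)) (Unique⇒length≤ (distinct C) (inside C))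
    ... | inj₂ (u , v , u∈P , u∉L , v∈L , v~u) | zero =
      ⊥-elim (<⇒≱ (∉⇒length< (distinct C) (inside C) u∈P u∉L) (subst (length P ≤_) (+-identityʳ _) bound))
    ... | inj₂ (u , v , u∈P , u∉L , v∈L , v~u) | suc fuel′ with adjacent⇒≈ (All.lookup (inside C) v∈L) u∈P v~u
    ...   | a , v≈u with extend-covering fuel′ C′ (subst (length P ≤_) (+-suc (length (tiles C)) fuel′) bound)
      where
        C′ : PartialCovering
        C′ = record
          { tiles    = u ∷ tiles C
          ; lines    = (perpendicular a , u) ∷ lines C
          ; nonempty = u , here refl
          ; distinct = Allₚ.¬Any⇒All¬ (tiles C) u∉L ∷ distinct C
          ; inside   = u∈P ∷ inside C
          ; covered  = covers-adjoined a u∈P v≈u (All.lookup (covered C) v∈L) ∷ All.map covers-∷ (covered C)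
          }
    ...     | G , cov , |G|≤ =
      G , cov , s≤s⁻¹ (≤-trans (≤-reflexive (≡.sym (+-suc (length G) (length (tiles C))))) |G|≤)

    covering-through : ∀ {t} → t ∈ P → ∃[ G ] Covering G × length G ≤ suc (length P)
    covering-through {t} t∈P with extend-covering (length P) single (m≤n+m (length P) 1)
      where
        single : PartialCovering
        single = record
          { tiles    = t ∷ []
          ; lines    = (horizontal , t) ∷ (vertical , t) ∷ []
          ; nonempty = t , here refl
          ; distinct = [] ∷ []
          ; inside   = t∈P ∷ []
          ; covered  = covers-both horizontal (here (≈-refl {horizontal} t∈P))
                                              (there (here (≈-refl {vertical} t∈P))) ∷ []
          }
    ... | G , cov , |G|+1≤ = G , cov , s≤s⁻¹ (≤-trans (≤-reflexive (+-comm 1 (length G))) |G|+1≤)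

    deficient⇒short-covering : DeficientCovering → ∃[ G ] Covering G × length G ≤ length P
    deficient⇒short-covering (C , |lines|≤|tiles|)
      with extend-covering (length P) C (m≤n+m (length P) (length (tiles C)))
    ... | G , cov , |G|+|tiles|≤ = G , cov , +-cancelʳ-≤ (length (tiles C)) (length G) (length P) (begin
      length G + length (tiles C)     ≤⟨ |G|+|tiles|≤ ⟩
      length (lines C) + length P     ≤⟨ +-monoˡ-≤ (length P) |lines|≤|tiles| ⟩
      length (tiles C) + length P     ≡⟨ +-comm (length (tiles C)) (length P) ⟩
      length P + length (tiles C)     ∎)
      where open ≤-Reasoning

    saturated⇒rook-on-every-line : ∀ {S} → IsRookSet P S → NonAttacking P S → Saturated S →
                                   ∀ {t} → t ∈ P → ∀ a → ∃[ r ] r ∈ S × (a , r) ≈ (a , t)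
    saturated⇒rook-on-every-line rs na saturated t∈P with covering-through t∈P
    ... | G , cov , |G|≤ = rook-on-every-line rs na cov (≤-trans |G|≤ (≤-reflexive (≡.sym saturated))) t∈P

    saturated⇒dominates : ∀ {S} → IsRookSet P S → NonAttacking P S → Saturated S → Dominates P S
    saturated⇒dominates rs na saturated t∈P with saturated⇒rook-on-every-line rs na saturated t∈P horizontal
    ... | r , r∈S , r≈t = r , r∈S , inj₂ (inj₁ r≈t)

    module SaturatedPair {S S′} (rs : IsRookSet P S) (na : NonAttacking P S) (saturated : Saturated S)
                         (rs′ : IsRookSet P S′) (na′ : NonAttacking P S′) (saturated′ : Saturated S′) where

      R : Axis → List Tile
      R horizontal = S
      R vertical   = S′

      R⊆P : ∀ a {r} → r ∈ R a → r ∈ P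
      R⊆P horizontal = proj₂ rs
      R⊆P vertical   = proj₂ rs′

      R-nonAttacking : ∀ a → NonAttacking P (R a)
      R-nonAttacking horizontal = na
      R-nonAttacking vertical   = na′

      rook : ∀ a {t} → t ∈ P → ∃[ r ] r ∈ R a × (a , r) ≈ (a , t)
      rook horizontal t∈P = saturated⇒rook-on-every-line rs na saturated t∈P horizontal
      rook vertical   t∈P = saturated⇒rook-on-every-line rs′ na′ saturated′ t∈P vertical

      open Alternation R R⊆P R-nonAttacking rook using (deficient-covering)

      S′⊆S : ∀ {t} → t ∈ S′ → t ∈ S
      S′⊆S {t} t∈S′ = decidable-stable (t ∈? S) λ t∉S →
        let G , cov , |G|≤|P| = deficient⇒short-covering (deficient-covering vertical t∈S′ t∉S)
        in  <⇒≱ (saturated⇒length< rs na saturated cov) |G|≤|P|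

theorem19 : (m : ℕ) (P : Tiles) → IsPolyomino P → length P + 1 ≡ 2 * m →
    (S : List Tile) → IsRookSet P S → length S ≡ m → NonAttacking P S →
    Dominates P S ×
    ((S' : List Tile) → IsRookSet P S' → length S' ≡ m → NonAttacking P S' →
      (∀ t → (t ∈ S' → t ∈ S) × (t ∈ S → t ∈ S')))
theorem19 m P isP |P|+1≡2m S rs |S|≡m na =
  saturated⇒dominates rs na (saturated S |S|≡m) ,
  λ S′ rs′ |S′|≡m na′ t →
    SaturatedPair.S′⊆S rs na (saturated S |S|≡m) rs′ na′ (saturated S′ |S′|≡m) ,
    SaturatedPair.S′⊆S rs′ na′ (saturated S′ |S′|≡m) rs na (saturated S |S|≡m)
  where
    open Lines P
    open Connected (IsPolyomino.connected isP)
    saturated : ∀ S → length S ≡ m → Saturated S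
    saturated S |S|≡m = begin
      length S + length S  ≡⟨ ≡.cong₂ _+_ |S|≡m |S|≡m ⟩
      m + m                ≡⟨ ≡.cong (m +_) (≡.sym (+-identityʳ m)) ⟩
      2 * m                ≡⟨ ≡.sym |P|+1≡2m ⟩
      length P + 1         ≡⟨ +-comm (length P) 1 ⟩
      suc (length P)       ∎
      where open ≡.≡-Reasoning
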